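{- For every integer $k\geq 1$ and every integer $t\geq 0$, the number of dominating $k$-sets of the path $P_{k+t}$ is \[ \gamma_k(P_{k+t})=\sum_{m=0}^{\lfloor t/2\rfloor+1}\binom{k-1}{t-m}\binom{t-m+2}{m}. \]
   Context: For a simple graph $G$, a set $D$ of vertices is dominating if every vertex not in $D$ is adjacent to some vertex of $D$; $\gamma_k(G)$ is the number of dominating sets of $G$ of cardinality exactly $k$. $P_n$ is the path with $n$ vertices. Binomial coefficients $\binom{a}{b}$ are taken to be $0$ when $b<0$ or $b>a$. -}

module Defs where

open import Data.Nat using (ℕ; zero; suc; _+_; _∸_; _≟_; _/_)
open import Data.Nat.Combinatorics using (_C_)
open import Data.Fin using (Fin; toℕ)
open import Data.Fin.Subset using (Subset; _∈_; _∉_; ∣_∣)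
open import Data.Fin.Subset.Properties using (_∈?_)
open import Data.Fin.Properties using (all?; any?)
open import Data.Vec using ([]; _∷_)
open import Data.Bool using (true; false)
open import Data.List using (List; []; _∷_; map; _++_; filter; length)
open import Data.Product using (Σ; _×_; _,_)
open import Data.Sum using (_⊎_)
open import Relation.Nullary using (Dec; ¬_)
open import Relation.Nullary.Decidable using (_×-dec_; _⊎-dec_; ¬?)
open import Relation.Binary.PropositionalEquality using (_≡_)

PathAdj : ∀ {n} → Fin n → Fin n → Set
PathAdj i j = (suc (toℕ i) ≡ toℕ j) ⊎ (suc (toℕ j) ≡ toℕ i)

pathAdj? : ∀ {n} (i j : Fin n) → Dec (PathAdj i j)
pathAdj? i j = (suc (toℕ i) ≟ toℕ j) ⊎-dec (suc (toℕ j) ≟ toℕ i)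

Dominating : ∀ {n} (Adj : Fin n → Fin n → Set) → Subset n → Set
Dominating {n} Adj D = (v : Fin n) → v ∉ D → Σ (Fin n) λ u → (u ∈ D) × Adj v u

dominating? : ∀ {n} {Adj : Fin n → Fin n → Set} →
              (∀ i j → Dec (Adj i j)) → (D : Subset n) → Dec (Dominating Adj D)
dominating? adj? D =
  all? λ v → (¬? (v ∈? D)) →-dec' (any? λ u → (u ∈? D) ×-dec adj? v u)
  where
  open import Relation.Nullary.Decidable using () renaming (_→-dec_ to _→-dec'_)

allSubsets : (n : ℕ) → List (Subset n)
allSubsets zero = [] ∷ []
allSubsets (suc n) = map (false ∷_) (allSubsets n) ++ map (true ∷_) (allSubsets n)

γ : (k n : ℕ) → ℕ
γ k n = length (filter (λ D → dominating? pathAdj? D ×-dec (∣ D ∣ ≟ k)) (allSubsets n))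

sumTo : ℕ → (ℕ → ℕ) → ℕ
sumTo zero f = f 0
sumTo (suc N) f = sumTo N f + f (suc N)

-- Binomial coefficient with integer lower index b = t - m, which is 0 when t - m < 0.
-- binomTM a t m = C(a, t - m) for m ≤ t, and 0 for m > t.
binomTM : ℕ → ℕ → ℕ → ℕ
binomTM a t m with m Data.Nat.≤? t
... | Relation.Nullary.yes _ = a C (t ∸ m)
... | Relation.Nullary.no _  = 0

-- Whether inside ∷ D or outside ∷ D dominates a path is decided by the tail D and by
-- whether the vertex before it is in D, dominated, or still waiting for a neighbour in D.
-- Counting subsets by these three states gives the recurrence
-- γ_{k+1}(P_{n+3}) = γ_k(P_{n+2}) + γ_k(P_{n+1}) + γ_k(P_n).  Hence, as a sequence in t,
-- γ_{j+1}(P_{j+1+t}) gets multiplied by 1 + x + x² when j grows, starting from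
-- γ_1(P_{1+t}) = C(2,t): it is the coefficient of xᵗ in (1 + x)² (1 + x + x²)ʲ.
-- Expanding (1 + x + x²)ʲ = (1 + x(1 + x))ʲ binomially, this coefficient is
-- Σ_{i + m = t} C(j,i) C(i+2,m), the claimed sum with i = t - m; it satisfies the same
-- recurrence by Pascal's rule, applied once to C(j,i) and once to C(i+2,m).
-- The terms with m > ⌊t/2⌋ + 1 vanish because then C(t-m+2, m) = 0.

module Submission where

open import Defs
open import Data.Nat
  using (ℕ; zero; suc; _+_; _*_; _∸_; _/_; _≥_; _≤_; _<_; _≤′_; ≤′-refl; ≤′-step; z≤n; s≤s; _≟_; _≤?_)
open import Data.Nat.Properties
  using (+-comm; +-suc; +-assoc; +-identityʳ; *-zeroʳ; *-identityˡ; *-comm; *-distribʳ-+; *-distribˡ-+;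
         ≤-refl; m≤n⇒m≤1+n; +-monoʳ-≤; suc-injective; n<1+n; ≤-<-connex; ≤⇒≤′; ≤′⇒≤; m≤m+n; m≤n+m;
         n∸n≡0; +-∸-assoc; m+[n∸m]≡n; <⇒≢; <⇒≱; ≰⇒>; +-commutativeSemigroup; module ≤-Reasoning)
open import Data.Nat.Divisibility using (∣-refl)
open import Data.Nat.DivMod using (m*n/n≡m; /-monoˡ-≤; +-distrib-/-∣ʳ)
open import Data.Nat.Combinatorics using (_C_; nCk+nC[k+1]≡[n+1]C[k+1]; k>n⇒nCk≡0)
open import Data.Nat.Tactic.RingSolver using (solve-∀)
open import Algebra.Properties.CommutativeSemigroup +-commutativeSemigroup using (interchange)
open import Data.Fin using (Fin; zero; suc)
open import Data.Fin.Subset using (Subset; inside; outside; _∈_; ∣_∣; Nonempty)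
open import Data.Fin.Subset.Properties using (∣p∣≤n; ∣⁅x⁆∣≡1; x∈⁅y⁆⇒x≡y; p⊆q⇒∣p∣≤∣q∣)
open import Data.Vec using (_∷_; here; there)
open import Data.List using (List; []; _∷_; _++_; map; filter; length)
open import Data.Bool using (true; false)
open import Data.List.Properties using (filter-++; filter-none; filter-≐; length-++)
import Data.List.Relation.Unary.All as All
open import Data.Product using (Σ; _×_; _,_)
import Data.Product as Product
import Data.Sum as Sum
open import Data.Sum using (inj₁; inj₂)
open import Data.Empty using (⊥-elim)
open import Function using (_∘_)
open import Function.Bundles using (_⇔_; mk⇔; Equivalence)
open import Level using (0ℓ)
open import Relation.Nullary using (¬_; does; yes; no)
open import Relation.Nullary.Decidable using (_×-dec_)
open import Relation.Unary using (Pred; Decidable; _≐_)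
open import Relation.Binary.PropositionalEquality
  using (_≡_; refl; sym; trans; cong; cong₂; subst; module ≡-Reasoning)

countSubsets : ∀ {n} {P : Pred (Subset n) 0ℓ} → Decidable P → ℕ
countSubsets {n} P? = length (filter P? (allSubsets n))

countSubsets-≐ : ∀ {n} {P Q : Pred (Subset n) 0ℓ} (P? : Decidable P) (Q? : Decidable Q) →
                 P ≐ Q → countSubsets P? ≡ countSubsets Q?
countSubsets-≐ {n} P? Q? P≐Q = cong length (filter-≐ P? Q? P≐Q (allSubsets n))

countSubsets-none : ∀ {n} {P : Pred (Subset n) 0ℓ} (P? : Decidable P) →
                    (∀ D → ¬ P D) → countSubsets P? ≡ 0
countSubsets-none {n} P? ¬P = cong length (filter-none P? (All.universal ¬P (allSubsets n)))

length-filter-map : ∀ {A B : Set} {P : Pred B 0ℓ} (P? : Decidable P) (f : A → B) (xs : List A) →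
                    length (filter P? (map f xs)) ≡ length (filter (P? ∘ f) xs)
length-filter-map P? f [] = refl
length-filter-map P? f (x ∷ xs) with does (P? (f x))
... | true  = cong suc (length-filter-map P? f xs)
... | false = length-filter-map P? f xs

countSubsets-∷ : ∀ {n} {P : Pred (Subset (suc n)) 0ℓ} (P? : Decidable P) →
                 countSubsets P? ≡
                 countSubsets (λ D → P? (outside ∷ D)) + countSubsets (λ D → P? (inside ∷ D))
countSubsets-∷ {n} P? = begin
  length (filter P? (outsides ++ insides))
    ≡⟨ cong length (filter-++ P? outsides insides) ⟩
  length (filter P? outsides ++ filter P? insides)
    ≡⟨ length-++ (filter P? outsides) ⟩
  length (filter P? outsides) + length (filter P? insides)
    ≡⟨ cong₂ _+_ (length-filter-map P? (outside ∷_) (allSubsets n))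
                 (length-filter-map P? (inside ∷_) (allSubsets n)) ⟩
  countSubsets (λ D → P? (outside ∷ D)) + countSubsets (λ D → P? (inside ∷ D)) ∎
  where
  open ≡-Reasoning
  outsides insides : List (Subset (suc n))
  outsides = map (outside ∷_) (allSubsets n)
  insides  = map (inside ∷_) (allSubsets n)

ofSize? : ∀ {n} {P : Pred (Subset n) 0ℓ} → Decidable P →
          (k : ℕ) → Decidable (λ D → P D × ∣ D ∣ ≡ k)
ofSize? P? k D = P? D ×-dec (∣ D ∣ ≟ k)

ofSize : ∀ {n} {P : Pred (Subset n) 0ℓ} → Decidable P → ℕ → ℕ
ofSize P? k = countSubsets (ofSize? P? k)

module _ {n} {P Q : Pred (Subset n) 0ℓ} (P? : Decidable P) (Q? : Decidable Q) where

  ofSize-cong : (∀ D → P D ⇔ Q D) → ∀ k → ofSize P? k ≡ ofSize Q? k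
  ofSize-cong P⇔Q k = countSubsets-≐ (ofSize? P? k) (ofSize? Q? k)
    ( Product.map₁ (Equivalence.to (P⇔Q _))
    , Product.map₁ (Equivalence.from (P⇔Q _)))

module _ {n} {P : Pred (Subset n) 0ℓ} (P? : Decidable P) where

  ofSize-none : (∀ D → ¬ P D) → ∀ k → ofSize P? k ≡ 0
  ofSize-none ¬P k = countSubsets-none (ofSize? P? k) (λ D → ¬P D ∘ Product.proj₁)

  ofSize-vanish : ∀ {k} → n < k → ofSize P? k ≡ 0
  ofSize-vanish {k} n<k = countSubsets-none (ofSize? P? k) λ D (_ , ∣D∣≡k) →
    <⇒≱ n<k (subst (_≤ n) ∣D∣≡k (∣p∣≤n D))

module _ {n} {P : Pred (Subset (suc n)) 0ℓ} (P? : Decidable P) where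

  private
    P⁻? : Decidable (λ D → P (outside ∷ D))
    P⁺? : Decidable (λ D → P (inside ∷ D))
    P⁻? D = P? (outside ∷ D)
    P⁺? D = P? (inside ∷ D)

  ofSize-∷-zero : ofSize P? 0 ≡ ofSize P⁻? 0
  ofSize-∷-zero = trans (countSubsets-∷ (ofSize? P? 0))
    (trans (cong (ofSize P⁻? 0 +_) (countSubsets-none (λ D → ofSize? P? 0 (inside ∷ D)) λ { _ (_ , ()) }))
           (+-identityʳ _))

  ofSize-∷-suc : ∀ k → ofSize P? (suc k) ≡ ofSize P⁻? (suc k) + ofSize P⁺? k
  ofSize-∷-suc k = trans (countSubsets-∷ (ofSize? P? (suc k)))
    (cong (ofSize P⁻? (suc k) +_)
          (countSubsets-≐ (λ D → ofSize? P? (suc k) (inside ∷ D)) (ofSize? P⁺? k)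
                          (Product.map₂ suc-injective , Product.map₂ (cong suc))))

-- Domination in paths

DominatesPath : ∀ {n} → Subset n → Set
DominatesPath = Dominating PathAdj

dominatesPath? : ∀ {n} → Decidable (DominatesPath {n})
dominatesPath? = dominating? pathAdj?

Dominator : ∀ {n} → Subset n → Fin n → Set
Dominator {n} D v = Σ (Fin n) λ u → u ∈ D × PathAdj v u

dominator-∷ : ∀ {n} {D : Subset n} {b v} → Dominator D v → Dominator (b ∷ D) (suc v)
dominator-∷ (u , u∈D , v~u) = suc u , there u∈D , Sum.map (cong suc) (cong suc) v~u

dominator-∷⁻ : ∀ {n} {D : Subset (suc n)} {b v} → Dominator (b ∷ D) (suc (suc v)) → Dominator D (suc v)
dominator-∷⁻ (zero  , _          , inj₁ ())
dominator-∷⁻ (zero  , _          , inj₂ ())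
dominator-∷⁻ (suc u , there u∈D , v~u) = u , u∈D , Sum.map suc-injective suc-injective v~u

dominator-outside⁻ : ∀ {n} {D : Subset n} {v} → Dominator (outside ∷ D) (suc v) → Dominator D v
dominator-outside⁻ (zero  , ()         , _)
dominator-outside⁻ (suc u , there u∈D , v~u) = u , u∈D , Sum.map suc-injective suc-injective v~u

dominatesPath-∷-inside : ∀ {n} {D : Subset n} {b} →
                         DominatesPath (b ∷ inside ∷ D) ⇔ DominatesPath (inside ∷ D)
dominatesPath-∷-inside = mk⇔
  (λ where dom zero    z∉ → ⊥-elim (z∉ here)
           dom (suc v) v∉ → dominator-∷⁻ (dom (suc (suc v)) λ { (there v∈) → v∉ v∈ }))
  (λ where dom zero    _  → suc zero , there here , inj₁ refl
           dom (suc v) v∉ → dominator-∷ (dom v (v∉ ∘ there)))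

dominatesPath-inside-outside : ∀ {n} {D : Subset n} →
                               DominatesPath (inside ∷ outside ∷ D) ⇔ DominatesPath D
dominatesPath-inside-outside = mk⇔
  (λ dom v v∉ → dominator-outside⁻ (dominator-∷⁻
     (dom (suc (suc v)) λ { (there (there v∈)) → v∉ v∈ })))
  (λ where dom zero          z∉ → ⊥-elim (z∉ here)
           dom (suc zero)    _  → zero , here , inj₂ refl
           dom (suc (suc v)) v∉ → dominator-∷ (dominator-∷ (dom v (v∉ ∘ there ∘ there))))

¬dominatesPath-outside-outside : ∀ {n} {D : Subset n} → ¬ DominatesPath (outside ∷ outside ∷ D)
¬dominatesPath-outside-outside dom with dom zero (λ ())
... | zero          , ()         , _
... | suc zero      , there ()   , _
... | suc (suc _)   , _          , inj₁ ()
... | suc (suc _)   , _          , inj₂ ()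

dominatesPath-nonempty : ∀ {n} {D : Subset (suc n)} → DominatesPath D → Nonempty D
dominatesPath-nonempty {D = inside  ∷ _} _   = zero , here
dominatesPath-nonempty {D = outside ∷ _} dom with dom zero (λ ())
... | u , u∈D , _ = u , u∈D

nonempty⇒∣p∣>0 : ∀ {n} {p : Subset n} → Nonempty p → 0 < ∣ p ∣
nonempty⇒∣p∣>0 {p = p} (x , x∈p) =
  subst (_≤ ∣ p ∣) (∣⁅x⁆∣≡1 x)
        (p⊆q⇒∣p∣≤∣q∣ λ y∈⁅x⁆ → subst (_∈ p) (sym (x∈⁅y⁆⇒x≡y x y∈⁅x⁆)) x∈p)

-- The recurrence for γ

γ⁺ γ⁻ : ℕ → ℕ → ℕ
γ⁺ k n = ofSize (λ (D : Subset n) → dominatesPath? (inside ∷ D)) k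
γ⁻ k n = ofSize (λ (D : Subset n) → dominatesPath? (outside ∷ D)) k

γ-vanish : ∀ {k n} → n < k → γ k n ≡ 0
γ-vanish = ofSize-vanish dominatesPath?

γ-zero-suc : ∀ n → γ 0 (suc n) ≡ 0
γ-zero-suc n = countSubsets-none (ofSize? (dominatesPath? {suc n}) 0) λ D (dom , ∣D∣≡0) →
  <⇒≢ (nonempty⇒∣p∣>0 (dominatesPath-nonempty dom)) (sym ∣D∣≡0)

γ-suc : ∀ k n → γ (suc k) (suc n) ≡ γ⁻ (suc k) n + γ⁺ k n
γ-suc k n = ofSize-∷-suc (dominatesPath? {suc n}) k

γ⁻-suc : ∀ k n → γ⁻ (suc k) (suc n) ≡ γ⁺ k n
γ⁻-suc k n = trans (ofSize-∷-suc (λ (D : Subset (suc n)) → dominatesPath? (outside ∷ D)) k)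
  (cong₂ _+_ (ofSize-none (λ (D : Subset n) → dominatesPath? (outside ∷ outside ∷ D))
                          (λ _ → ¬dominatesPath-outside-outside) (suc k))
             (ofSize-cong (λ (D : Subset n) → dominatesPath? (outside ∷ inside ∷ D))
                          (λ D → dominatesPath? (inside ∷ D)) (λ _ → dominatesPath-∷-inside) k))

γ⁺-suc-zero : ∀ n → γ⁺ 0 (suc n) ≡ γ 0 n
γ⁺-suc-zero n = trans (ofSize-∷-zero (λ (D : Subset (suc n)) → dominatesPath? (inside ∷ D)))
  (ofSize-cong (λ (D : Subset n) → dominatesPath? (inside ∷ outside ∷ D)) dominatesPath?
               (λ _ → dominatesPath-inside-outside) 0)

γ⁺-suc : ∀ k n → γ⁺ (suc k) (suc n) ≡ γ (suc k) n + γ⁺ k n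
γ⁺-suc k n = trans (ofSize-∷-suc (λ (D : Subset (suc n)) → dominatesPath? (inside ∷ D)) k)
  (cong₂ _+_ (ofSize-cong (λ (D : Subset n) → dominatesPath? (inside ∷ outside ∷ D)) dominatesPath?
                          (λ _ → dominatesPath-inside-outside) (suc k))
             (ofSize-cong (λ (D : Subset n) → dominatesPath? (inside ∷ inside ∷ D))
                          (λ D → dominatesPath? (inside ∷ D)) (λ _ → dominatesPath-∷-inside) k))

γ-suc-suc : ∀ k n → γ (suc k) (2 + n) ≡ γ⁺ k n + γ⁺ k (1 + n)
γ-suc-suc k n = trans (γ-suc k (suc n)) (cong (_+ γ⁺ k (1 + n)) (γ⁻-suc k n))

γ-recurrence : ∀ k n → γ (suc k) (3 + n) ≡ γ k (2 + n) + γ k (1 + n) + γ k n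
γ-recurrence zero n = begin
  γ 1 (3 + n)                       ≡⟨ γ-suc-suc 0 (suc n) ⟩
  γ⁺ 0 (1 + n) + γ⁺ 0 (2 + n)       ≡⟨ cong₂ _+_ (γ⁺-suc-zero n) (γ⁺-suc-zero (suc n)) ⟩
  γ 0 n + γ 0 (1 + n)               ≡⟨ +-comm (γ 0 n) _ ⟩
  γ 0 (1 + n) + γ 0 n               ≡⟨ cong (λ z → z + γ 0 (1 + n) + γ 0 n) (γ-zero-suc (suc n)) ⟨
  γ 0 (2 + n) + γ 0 (1 + n) + γ 0 n ∎
  where open ≡-Reasoning
γ-recurrence (suc k) n = begin
  γ (2 + k) (3 + n)
    ≡⟨ γ-suc-suc (suc k) (suc n) ⟩
  γ⁺ (suc k) (1 + n) + γ⁺ (suc k) (2 + n)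
    ≡⟨ cong₂ _+_ (γ⁺-suc k n) (γ⁺-suc k (suc n)) ⟩
  (γ (suc k) n + γ⁺ k n) + (γ (suc k) (1 + n) + γ⁺ k (1 + n))
    ≡⟨ regroup (γ (suc k) n) (γ⁺ k n) (γ (suc k) (1 + n)) (γ⁺ k (1 + n)) ⟩
  (γ⁺ k n + γ⁺ k (1 + n)) + γ (suc k) (1 + n) + γ (suc k) n
    ≡⟨ cong (λ z → z + γ (suc k) (1 + n) + γ (suc k) n) (γ-suc-suc k n) ⟨
  γ (suc k) (2 + n) + γ (suc k) (1 + n) + γ (suc k) n ∎
  where
  open ≡-Reasoning
  regroup : ∀ a x b y → (a + x) + (b + y) ≡ (x + y) + b + a
  regroup = solve-∀

γ⁺-diagonal : ∀ k → γ⁺ k k ≡ 1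
γ⁺-diagonal zero    = refl
γ⁺-diagonal (suc k) = trans (γ⁺-suc k k) (cong₂ _+_ (γ-vanish (n<1+n k)) (γ⁺-diagonal k))

γ-diagonal : ∀ k → γ (suc k) (suc k) ≡ 1
γ-diagonal k = trans (γ-suc k k)
  (cong₂ _+_ (ofSize-vanish (λ D → dominatesPath? (outside ∷ D)) (n<1+n k)) (γ⁺-diagonal k))

γ-one : ∀ t → γ 1 (suc t) ≡ 2 C t
γ-one 0 = refl
γ-one 1 = refl
γ-one 2 = refl
γ-one (suc (suc (suc t))) = begin
  γ 1 (3 + suc t)                                 ≡⟨ γ-recurrence 0 (suc t) ⟩
  γ 0 (2 + suc t) + γ 0 (1 + suc t) + γ 0 (suc t)
    ≡⟨ cong₂ _+_ (cong₂ _+_ (γ-zero-suc (2 + t)) (γ-zero-suc (1 + t))) (γ-zero-suc t) ⟩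
  0                                               ≡⟨ k>n⇒nCk≡0 {2} {3 + t} (s≤s (s≤s (s≤s z≤n))) ⟨
  2 C (3 + t)                                     ∎
  where open ≡-Reasoning

-- Coefficients of (1 + x)² (1 + x + x²)ʲ

-- shift f is the coefficient sequence of x times the series with coefficients f;
-- coeff j t is the coefficient of xᵗ in (1 + x)² (1 + x + x²)ʲ.
shift : (ℕ → ℕ) → ℕ → ℕ
shift f zero    = 0
shift f (suc t) = f t

coeff : ℕ → ℕ → ℕ
coeff zero    t = 2 C t
coeff (suc j) t = coeff j t + shift (coeff j) t + shift (shift (coeff j)) t

shift-cong : ∀ {f g : ℕ → ℕ} → (∀ t → f t ≡ g t) → ∀ t → shift f t ≡ shift g t
shift-cong f≗g zero    = refl
shift-cong f≗g (suc t) = f≗g t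

coeff-unique : (F : ℕ → ℕ → ℕ) →
               (∀ t → F 0 t ≡ 2 C t) →
               (∀ j t → F (suc j) t ≡ F j t + shift (F j) t + shift (shift (F j)) t) →
               ∀ j t → F j t ≡ coeff j t
coeff-unique F base step zero    t = base t
coeff-unique F base step (suc j) t = trans (step j t)
  (cong₂ _+_ (cong₂ _+_ (F≗coeff t) (shift-cong F≗coeff t)) (shift-cong (shift-cong F≗coeff) t))
  where
  F≗coeff : ∀ t → F j t ≡ coeff j t
  F≗coeff = coeff-unique F base step j

-- γRow j t = γ_{j+1}(P_{j+1+t}), with the index written t + suc j so that it reduces in t.
γRow : ℕ → ℕ → ℕ
γRow j t = γ (suc j) (t + suc j)

γRow-zero : ∀ t → γRow 0 t ≡ 2 C t
γRow-zero t = trans (cong (γ 1) (+-comm t 1)) (γ-one t)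

γRow-suc : ∀ j t → γRow (suc j) t ≡ γRow j t + shift (γRow j) t + shift (shift (γRow j)) t
γRow-suc j zero = begin
  γ (2 + j) (2 + j)             ≡⟨ γ-diagonal (suc j) ⟩
  1                             ≡⟨ γ-diagonal j ⟨
  γ (suc j) (suc j)             ≡⟨ +-identityʳ _ ⟨
  γ (suc j) (suc j) + 0         ≡⟨ +-identityʳ _ ⟨
  γ (suc j) (suc j) + 0 + 0     ∎
  where open ≡-Reasoning
γRow-suc j (suc zero) = trans (γ-recurrence (suc j) j)
  (cong (γ (suc j) (2 + j) + γ (suc j) (1 + j) +_) (γ-vanish (n<1+n j)))
γRow-suc j (suc (suc s)) =
  trans (cong (γ (2 + j)) (cong (2 +_) (+-suc s (suc j)))) (γ-recurrence (suc j) (s + suc j))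

γRow≡coeff : ∀ j t → γRow j t ≡ coeff j t
γRow≡coeff = coeff-unique γRow γRow-zero γRow-suc

sumTo-cong-≤ : ∀ N {f g : ℕ → ℕ} → (∀ m → m ≤ N → f m ≡ g m) → sumTo N f ≡ sumTo N g
sumTo-cong-≤ zero    f≗g = f≗g 0 z≤n
sumTo-cong-≤ (suc N) f≗g =
  cong₂ _+_ (sumTo-cong-≤ N λ m m≤N → f≗g m (m≤n⇒m≤1+n m≤N)) (f≗g (suc N) ≤-refl)

sumTo-+ : ∀ N (f g : ℕ → ℕ) → sumTo N (λ m → f m + g m) ≡ sumTo N f + sumTo N g
sumTo-+ zero    f g = refl
sumTo-+ (suc N) f g =
  trans (cong (_+ (f (suc N) + g (suc N))) (sumTo-+ N f g))
        (interchange (sumTo N f) (sumTo N g) (f (suc N)) (g (suc N)))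

sumTo-sucˡ : ∀ N (f : ℕ → ℕ) → sumTo (suc N) f ≡ f 0 + sumTo N (f ∘ suc)
sumTo-sucˡ zero    f = refl
sumTo-sucˡ (suc N) f = trans (cong (_+ f (2 + N)) (sumTo-sucˡ N f)) (+-assoc (f 0) _ _)

sumTo-zero : ∀ N → sumTo N (λ _ → 0) ≡ 0
sumTo-zero zero    = refl
sumTo-zero (suc N) = cong (_+ 0) (sumTo-zero N)

sumTo-extend : ∀ {N M} (f : ℕ → ℕ) → N ≤′ M → (∀ m → N < m → f m ≡ 0) → sumTo M f ≡ sumTo N f
sumTo-extend f ≤′-refl          _      = refl
sumTo-extend f (≤′-step N≤′M) vanish = trans
  (cong₂ _+_ (sumTo-extend f N≤′M vanish) (vanish _ (s≤s (≤′⇒≤ N≤′M))))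
  (+-identityʳ _)

sumTo-trim : ∀ {N M} (f : ℕ → ℕ) → (∀ m → N < m → f m ≡ 0) → (∀ m → M < m → f m ≡ 0) →
             sumTo N f ≡ sumTo M f
sumTo-trim {N} {M} f vanishN vanishM = trans
  (sym (sumTo-extend f (≤⇒≤′ (m≤m+n N M)) vanishN))
  (sumTo-extend f (≤⇒≤′ (m≤n+m M N)) vanishM)

antidiagonalSum : ℕ → (ℕ → ℕ → ℕ) → ℕ
antidiagonalSum t f = sumTo t (λ m → f (t ∸ m) m)

antidiagonalSum-cong : ∀ t {f g : ℕ → ℕ → ℕ} → (∀ i m → f i m ≡ g i m) →
                       antidiagonalSum t f ≡ antidiagonalSum t g
antidiagonalSum-cong t f≗g = sumTo-cong-≤ t λ m _ → f≗g (t ∸ m) m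

antidiagonalSum-+ : ∀ t (f g : ℕ → ℕ → ℕ) →
  antidiagonalSum t (λ i m → f i m + g i m) ≡ antidiagonalSum t f + antidiagonalSum t g
antidiagonalSum-+ t f g = sumTo-+ t (λ m → f (t ∸ m) m) (λ m → g (t ∸ m) m)

antidiagonalSum-suc : ∀ t (f : ℕ → ℕ → ℕ) →
                      antidiagonalSum (suc t) f ≡ antidiagonalSum t (λ i m → f (suc i) m) + f 0 (suc t)
antidiagonalSum-suc t f = cong₂ _+_
  (sumTo-cong-≤ t λ m m≤t → cong (λ i → f i m) (+-∸-assoc 1 m≤t))
  (cong (λ i → f i (suc t)) (n∸n≡0 t))

antidiagonalSum-shiftˡ : ∀ t (f : ℕ → ℕ → ℕ) →
  antidiagonalSum t (λ i m → shift (λ i′ → f i′ m) i) ≡ shift (λ s → antidiagonalSum s f) t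
antidiagonalSum-shiftˡ zero    f = refl
antidiagonalSum-shiftˡ (suc t) f =
  trans (antidiagonalSum-suc t (λ i m → shift (λ i′ → f i′ m) i)) (+-identityʳ _)

antidiagonalSum-shiftʳ : ∀ t (f : ℕ → ℕ → ℕ) →
  antidiagonalSum t (λ i m → shift (f i) m) ≡ shift (λ s → antidiagonalSum s f) t
antidiagonalSum-shiftʳ zero    f = refl
antidiagonalSum-shiftʳ (suc t) f = sumTo-sucˡ t (λ m → shift (f (suc t ∸ m)) m)

-- The binomial sum

pascal : ∀ n k → suc n C k ≡ n C k + shift (n C_) k
pascal n zero    = refl
pascal n (suc k) = trans (sym (nCk+nC[k+1]≡[n+1]C[k+1] n k)) (+-comm (n C k) _)

*-shift : ∀ a (f : ℕ → ℕ) m → a * shift f m ≡ shift (λ m′ → a * f m′) m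
*-shift a f zero    = *-zeroʳ a
*-shift a f (suc m) = refl

shift-* : ∀ (f g : ℕ → ℕ) i → shift f i * g i ≡ shift (λ i′ → f i′ * g (suc i′)) i
shift-* f g zero    = refl
shift-* f g (suc i) = refl

shift-+ : ∀ (f g : ℕ → ℕ) t → shift (λ s → f s + g s) t ≡ shift f t + shift g t
shift-+ f g zero    = refl
shift-+ f g (suc t) = refl

-- The sum of the theorem, reindexed by i = t ∸ m: Σ_{i + m = t} C(j,i) C(i+2,m).
binomialTerm : ℕ → ℕ → ℕ → ℕ
binomialTerm j i m = (j C i) * ((i + 2) C m)

binomialSum : ℕ → ℕ → ℕ
binomialSum j t = antidiagonalSum t (binomialTerm j)

binomialSum-zero : ∀ t → binomialSum 0 t ≡ 2 C t
binomialSum-zero zero    = refl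
binomialSum-zero (suc t) = begin
  binomialSum 0 (suc t)              ≡⟨ antidiagonalSum-suc t (binomialTerm 0) ⟩
  sumTo t (λ _ → 0) + 1 * (2 C suc t) ≡⟨ cong₂ _+_ (sumTo-zero t) (*-identityˡ (2 C suc t)) ⟩
  2 C suc t                          ∎
  where open ≡-Reasoning

binomialSum-suc : ∀ j t → binomialSum (suc j) t ≡
                  binomialSum j t + shift (binomialSum j) t + shift (shift (binomialSum j)) t
binomialSum-suc j t = begin
  binomialSum (suc j) t
    ≡⟨ antidiagonalSum-cong t pascalˡ ⟩
  antidiagonalSum t (λ i m → binomialTerm j i m + shift (λ i′ → raised i′ m) i)
    ≡⟨ antidiagonalSum-+ t (binomialTerm j) (λ i m → shift (λ i′ → raised i′ m) i) ⟩
  binomialSum j t + antidiagonalSum t (λ i m → shift (λ i′ → raised i′ m) i)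
    ≡⟨ cong (binomialSum j t +_) (antidiagonalSum-shiftˡ t raised) ⟩
  binomialSum j t + shift (λ s → antidiagonalSum s raised) t
    ≡⟨ cong (binomialSum j t +_) (shift-cong pascalʳ t) ⟩
  binomialSum j t + shift (λ s → binomialSum j s + shift (binomialSum j) s) t
    ≡⟨ cong (binomialSum j t +_) (shift-+ (binomialSum j) (shift (binomialSum j)) t) ⟩
  binomialSum j t + (shift (binomialSum j) t + shift (shift (binomialSum j)) t)
    ≡⟨ +-assoc (binomialSum j t) _ _ ⟨
  binomialSum j t + shift (binomialSum j) t + shift (shift (binomialSum j)) t ∎
  where
  open ≡-Reasoning
  raised : ℕ → ℕ → ℕ
  raised i m = (j C i) * ((suc i + 2) C m)
  pascalˡ : ∀ i m → binomialTerm (suc j) i m ≡ binomialTerm j i m + shift (λ i′ → raised i′ m) i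
  pascalˡ i m = begin
    (suc j C i) * ((i + 2) C m)
      ≡⟨ cong (_* ((i + 2) C m)) (pascal j i) ⟩
    (j C i + shift (j C_) i) * ((i + 2) C m)
      ≡⟨ *-distribʳ-+ ((i + 2) C m) (j C i) _ ⟩
    binomialTerm j i m + shift (j C_) i * ((i + 2) C m)
      ≡⟨ cong (binomialTerm j i m +_) (shift-* (j C_) (λ i → (i + 2) C m) i) ⟩
    binomialTerm j i m + shift (λ i′ → raised i′ m) i ∎
  pascalʳ : ∀ s → antidiagonalSum s raised ≡ binomialSum j s + shift (binomialSum j) s
  pascalʳ s = begin
    antidiagonalSum s raised
      ≡⟨ antidiagonalSum-cong s (λ i m → trans (cong ((j C i) *_) (pascal (i + 2) m))
           (trans (*-distribˡ-+ (j C i) _ _) (cong (binomialTerm j i m +_) (*-shift (j C i) _ m)))) ⟩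
    antidiagonalSum s (λ i m → binomialTerm j i m + shift (binomialTerm j i) m)
      ≡⟨ antidiagonalSum-+ s (binomialTerm j) (λ i m → shift (binomialTerm j i) m) ⟩
    binomialSum j s + antidiagonalSum s (λ i m → shift (binomialTerm j i) m)
      ≡⟨ cong (binomialSum j s +_) (antidiagonalSum-shiftʳ s (binomialTerm j)) ⟩
    binomialSum j s + shift (binomialSum j) s ∎

binomialSum≡coeff : ∀ j t → binomialSum j t ≡ coeff j t
binomialSum≡coeff = coeff-unique binomialSum binomialSum-zero binomialSum-suc

binomTM-≤ : ∀ a {t m} → m ≤ t → binomTM a t m ≡ a C (t ∸ m)
binomTM-≤ a {t} {m} m≤t with m ≤? t
... | yes _   = refl
... | no  m≰t = ⊥-elim (m≰t m≤t)

binomTM-> : ∀ a {t m} → t < m → binomTM a t m ≡ 0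
binomTM-> a {t} {m} t<m with m ≤? t
... | yes m≤t = ⊥-elim (<⇒≱ t<m m≤t)
... | no  _   = refl

summand : ℕ → ℕ → ℕ → ℕ
summand j t m = binomTM j t m * ((t ∸ m + 2) C m)

sumTo-summand≡binomialSum : ∀ j t → sumTo t (summand j t) ≡ binomialSum j t
sumTo-summand≡binomialSum j t = sumTo-cong-≤ t λ m m≤t → cong (_* ((t ∸ m + 2) C m)) (binomTM-≤ j m≤t)

m≤t∸m+2⇒m≤t/2+1 : ∀ {t m} → m ≤ t → m ≤ t ∸ m + 2 → m ≤ t / 2 + 1
m≤t∸m+2⇒m≤t/2+1 {t} {m} m≤t m≤t∸m+2 = begin
  m               ≡⟨ m*n/n≡m m 2 ⟨
  m * 2 / 2       ≤⟨ /-monoˡ-≤ 2 m*2≤t+2 ⟩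
  (t + 2) / 2     ≡⟨ +-distrib-/-∣ʳ t ∣-refl ⟩
  t / 2 + 1       ∎
  where
  open ≤-Reasoning
  m*2≤t+2 : m * 2 ≤ t + 2
  m*2≤t+2 = begin
    m * 2               ≡⟨ *-comm m 2 ⟩
    m + (m + 0)         ≡⟨ cong (m +_) (+-identityʳ m) ⟩
    m + m               ≤⟨ +-monoʳ-≤ m m≤t∸m+2 ⟩
    m + (t ∸ m + 2)     ≡⟨ +-assoc m (t ∸ m) 2 ⟨
    m + (t ∸ m) + 2     ≡⟨ cong (_+ 2) (m+[n∸m]≡n m≤t) ⟩
    t + 2               ∎

summand-vanish-beyond : ∀ j t m → t < m → summand j t m ≡ 0
summand-vanish-beyond j t m t<m = cong (_* ((t ∸ m + 2) C m)) (binomTM-> j t<m)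

summand-vanish : ∀ j t m → t / 2 + 1 < m → summand j t m ≡ 0
summand-vanish j t m t/2+1<m with ≤-<-connex m t
... | inj₂ t<m = summand-vanish-beyond j t m t<m
... | inj₁ m≤t = trans (cong (binomTM j t m *_) (k>n⇒nCk≡0 t∸m+2<m)) (*-zeroʳ (binomTM j t m))
  where
  t∸m+2<m : t ∸ m + 2 < m
  t∸m+2<m = ≰⇒> λ m≤t∸m+2 → <⇒≱ t/2+1<m (m≤t∸m+2⇒m≤t/2+1 m≤t m≤t∸m+2)

mainTheorem6 : (k t : ℕ) → k ≥ 1 →
    γ k (k + t) ≡ sumTo (t / 2 + 1) (λ m → binomTM (k ∸ 1) t m * ((t ∸ m + 2) C m))
mainTheorem6 (suc j) t _ = begin
  γ (suc j) (suc j + t)        ≡⟨ cong (γ (suc j)) (+-comm (suc j) t) ⟩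
  γRow j t                     ≡⟨ γRow≡coeff j t ⟩
  coeff j t                    ≡⟨ binomialSum≡coeff j t ⟨
  binomialSum j t              ≡⟨ sumTo-summand≡binomialSum j t ⟨
  sumTo t (summand j t)        ≡⟨ sumTo-trim (summand j t) (summand-vanish-beyond j t) (summand-vanish j t) ⟩
  sumTo (t / 2 + 1) (summand j t) ∎
  where open ≡-Reasoning
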